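{- Let $n\ge2$ and let $A$ be a real $n\times n$ matrix such that $n-2$ of its rows are identical (all equal to some row vector $\mathbf b^T$) and the remaining two rows are identical to each other (both equal to some row vector $\mathbf a^T$). Then $\operatorname{dih}(A)=0$.
   Context: For $n\ge1$ and $k=1,\dots,n$, let $\rho_k$ be the permutation of $\{1,\dots,n\}$ with $\rho_k(1)=k,\rho_k(2)=k+1,\dots,\rho_k(n-k+1)=n,\rho_k(n-k+2)=1,\dots,\rho_k(n)=k-1$, and let $\mu_k$ be the permutation with $\mu_k(1)=k,\mu_k(2)=k-1,\dots,\mu_k(k)=1,\mu_k(k+1)=n,\mu_k(k+2)=n-1,\dots,\mu_k(n)=k+1$. For an $n\times n$ matrix $A=(a_{i,j})$, the dihedrant is $$\operatorname{dih}(A)=\sum_{k=1}^n\prod_{i=1}^n a_{i,\rho_k(i)}-\sum_{k=1}^n\prod_{i=1}^n a_{i,\mu_k(i)}.$$ -}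

module Defs where

open import Level using (Level)
open import Algebra.Bundles using (CommutativeRing)
open import Data.Nat as ℕ using (ℕ; zero; suc; NonZero)
open import Data.Nat.DivMod using (_%_; m%n<n)
open import Data.Fin as Fin using (Fin; toℕ; fromℕ<)

-- Index conventions: Fin n is {0,…,n-1}; the paper's index i ∈ {1,…,n}
-- corresponds to i-1, and the paper's k ∈ {1,…,n} corresponds to k-1.

-- ρ_k(i) = k + i - 1 (mod n, in 1..n); 0-indexed: ρ k i = (i + k) mod n
ρ : (n : ℕ) → .{{_ : NonZero n}} → Fin n → Fin n → Fin n
ρ n k i = fromℕ< (m%n<n (toℕ i ℕ.+ toℕ k) n)

-- μ_k(i) = k + 1 - i (mod n, in 1..n); 0-indexed: μ k i = (k - i) mod n
μ : (n : ℕ) → .{{_ : NonZero n}} → Fin n → Fin n → Fin n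
μ n k i = fromℕ< (m%n<n (toℕ k ℕ.+ (n ℕ.∸ toℕ i)) n)

module Dih {c ℓ : Level} (R : CommutativeRing c ℓ) where
  open CommutativeRing R

  ∑ : ∀ {n} → (Fin n → Carrier) → Carrier
  ∑ {zero} f = 0#
  ∑ {suc n} f = f Fin.zero + ∑ (λ i → f (Fin.suc i))

  ∏ : ∀ {n} → (Fin n → Carrier) → Carrier
  ∏ {zero} f = 1#
  ∏ {suc n} f = f Fin.zero * ∏ (λ i → f (Fin.suc i))

  Matrix : ℕ → Set c
  Matrix n = Fin n → Fin n → Carrier

  dih : (n : ℕ) → .{{_ : NonZero n}} → Matrix n → Carrier
  dih n A = ∑ (λ k → ∏ (λ i → A i (ρ n k i)))
          - ∑ (λ k → ∏ (λ i → A i (μ n k i)))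

module Submission where

-- For a permutation π of the columns, the diagonal product
-- ∏ᵢ A i (π i) only depends on the two columns π p and π q hit by the
-- rows p and q: it equals  diagonal (π p) (π q) = ∏ⱼ (a j if j ∈ {π p, π q}
-- else b j),  a symmetric function of π p and π q.  Identify Fin n with
-- the cyclic group ℤ/n.  Then ρ_k is the translation i ↦ i ⊕ k and μ_k is
-- the reflection i ↦ k ⊖ i, so with  G k = diagonal (p ⊕ k) (q ⊕ k)
--   ∑ₖ ∏ᵢ A i (ρ_k i) = ∑ₖ G k,
--   ∑ₖ ∏ᵢ A i (μ_k i) = ∑ₖ diagonal (k ⊖ p) (k ⊖ q) = ∑ₖ G (k ⊖ (p ⊕ q)) = ∑ₖ G k,
-- using symmetry of diagonal and the reindexing k ↦ k ⊖ (p ⊕ q).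

open import Defs
open import Level using (Level; 0ℓ)
open import Algebra.Bundles using (CommutativeRing; CommutativeMonoid; AbelianGroup)
open import Data.Nat using (ℕ; NonZero; _≤_)
open import Data.Fin using (Fin)
open import Data.Sum using (_⊎_)
open import Relation.Binary.PropositionalEquality using (_≡_; _≢_)

import Data.Nat as Nat
import Data.Nat.Properties as ℕₚ
open import Data.Nat.DivMod using (m%n<n; %-distribˡ-+; m%n%n≡m%n; m<n⇒m%n≡m; [m+n]%n≡m%n)
open import Data.Fin using (toℕ; fromℕ<; _≟_)
open import Data.Fin.Properties using (toℕ-fromℕ<; toℕ-injective; toℕ<n)
open import Data.Fin.Permutation
  using (Permutation′; permutation; flip; _⟨$⟩ʳ_; _⟨$⟩ˡ_; inverseˡ; inverseʳ)
open import Data.Product using (_,_)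
open import Data.Sum using (inj₁; inj₂)
open import Relation.Nullary using (yes; no)
open import Relation.Binary.PropositionalEquality
  using (refl; sym; trans; cong; cong₂; isEquivalence; module ≡-Reasoning)
import Algebra.Properties.AbelianGroup as AbelianGroupProperties
import Algebra.Properties.CommutativeMonoid.Sum as CommutativeMonoidSum
import Relation.Binary.Reasoning.Setoid as SetoidReasoning

module DifferenceIdentities {a ℓ : Level} (G : AbelianGroup a ℓ) where
  open AbelianGroup G
  open AbelianGroupProperties G
  open SetoidReasoning setoid

  reflection-involutive : ∀ x y → x - (x - y) ≈ y
  reflection-involutive x y = begin
    x ∙ (x - y) ⁻¹  ≈⟨ ∙-congˡ (⁻¹-anti-homo‿- x y) ⟩
    x ∙ (y - x)     ≈⟨ assoc x y (x ⁻¹) ⟨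
    x ∙ y ∙ x ⁻¹    ≈⟨ xyx⁻¹≈y x y ⟩
    y               ∎

  -- translating the reflection x - (y ∙ z) by y gives the reflection x - z;
  -- this matches the μ-terms of the dihedrant with shifted ρ-terms
  translate-reflection : ∀ x y z → y ∙ (x - (y ∙ z)) ≈ x - z
  translate-reflection x y z = begin
    y ∙ (x ∙ (y ∙ z) ⁻¹)    ≈⟨ ∙-congˡ (∙-congˡ (⁻¹-anti-homo-∙ y z)) ⟩
    y ∙ (x ∙ (z ⁻¹ ∙ y ⁻¹)) ≈⟨ ∙-congˡ (assoc x (z ⁻¹) (y ⁻¹)) ⟨
    y ∙ ((x - z) - y)       ≈⟨ comm y _ ⟩
    ((x - z) - y) ∙ y       ≈⟨ //-rightDividesˡ y (x - z) ⟩
    x - z                   ∎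

module Cyclic (n : ℕ) .{{_ : NonZero n}} where
  open Nat using (_+_; _∸_; _%_)
  open ≡-Reasoning

  [_] : ℕ → Fin n
  [ x ] = fromℕ< (m%n<n x n)

  []-cong : ∀ {x y} → x % n ≡ y % n → [ x ] ≡ [ y ]
  []-cong {x} {y} x≡y = toℕ-injective (begin
    toℕ [ x ]  ≡⟨ toℕ-fromℕ< _ ⟩
    x % n      ≡⟨ x≡y ⟩
    y % n      ≡⟨ toℕ-fromℕ< _ ⟨
    toℕ [ y ]  ∎)

  []-toℕ : ∀ i → [ toℕ i ] ≡ i
  []-toℕ i = toℕ-injective (trans (toℕ-fromℕ< _) (m<n⇒m%n≡m (toℕ<n i)))

  []-absorbˡ : ∀ x y → [ toℕ [ x ] + y ] ≡ [ x + y ]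
  []-absorbˡ x y = []-cong (begin
    (toℕ [ x ] + y) % n      ≡⟨ cong (λ r → (r + y) % n) (toℕ-fromℕ< _) ⟩
    (x % n + y) % n          ≡⟨ %-distribˡ-+ (x % n) y n ⟩
    (x % n % n + y % n) % n  ≡⟨ cong (λ r → (r + y % n) % n) (m%n%n≡m%n x n) ⟩
    (x % n + y % n) % n      ≡⟨ %-distribˡ-+ x y n ⟨
    (x + y) % n              ∎)

  []-absorbʳ : ∀ x y → [ x + toℕ [ y ] ] ≡ [ x + y ]
  []-absorbʳ x y = begin
    [ x + toℕ [ y ] ]  ≡⟨ cong [_] (ℕₚ.+-comm x _) ⟩
    [ toℕ [ y ] + x ]  ≡⟨ []-absorbˡ y x ⟩
    [ y + x ]          ≡⟨ cong [_] (ℕₚ.+-comm y x) ⟩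
    [ x + y ]          ∎

  infixl 6 _⊕_
  infix 8 ⊖_

  _⊕_ : Fin n → Fin n → Fin n
  i ⊕ j = [ toℕ i + toℕ j ]

  ⊖_ : Fin n → Fin n
  ⊖ i = [ n ∸ toℕ i ]

  𝟘 : Fin n
  𝟘 = [ 0 ]

  ⊕-assoc : ∀ i j k → (i ⊕ j) ⊕ k ≡ i ⊕ (j ⊕ k)
  ⊕-assoc i j k = begin
    [ toℕ [ toℕ i + toℕ j ] + toℕ k ]  ≡⟨ []-absorbˡ (toℕ i + toℕ j) (toℕ k) ⟩
    [ toℕ i + toℕ j + toℕ k ]          ≡⟨ cong [_] (ℕₚ.+-assoc (toℕ i) (toℕ j) (toℕ k)) ⟩
    [ toℕ i + (toℕ j + toℕ k) ]        ≡⟨ []-absorbʳ (toℕ i) (toℕ j + toℕ k) ⟨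
    [ toℕ i + toℕ [ toℕ j + toℕ k ] ]  ∎

  ⊕-comm : ∀ i j → i ⊕ j ≡ j ⊕ i
  ⊕-comm i j = cong [_] (ℕₚ.+-comm (toℕ i) (toℕ j))

  ⊕-identityˡ : ∀ i → 𝟘 ⊕ i ≡ i
  ⊕-identityˡ i = trans ([]-absorbˡ 0 (toℕ i)) ([]-toℕ i)

  ⊖-inverseˡ : ∀ i → ⊖ i ⊕ i ≡ 𝟘
  ⊖-inverseˡ i = begin
    [ toℕ [ n ∸ toℕ i ] + toℕ i ]  ≡⟨ []-absorbˡ (n ∸ toℕ i) (toℕ i) ⟩
    [ n ∸ toℕ i + toℕ i ]          ≡⟨ cong [_] (ℕₚ.m∸n+n≡m (ℕₚ.<⇒≤ (toℕ<n i))) ⟩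
    [ n ]                          ≡⟨ []-cong ([m+n]%n≡m%n 0 n) ⟩
    𝟘                              ∎

  cyclicGroup : AbelianGroup 0ℓ 0ℓ
  cyclicGroup = record
    { Carrier = Fin n ; _≈_ = _≡_ ; _∙_ = _⊕_ ; ε = 𝟘 ; _⁻¹ = ⊖_
    ; isAbelianGroup = record
      { isGroup = record
        { isMonoid = record
          { isSemigroup = record
            { isMagma = record { isEquivalence = isEquivalence ; ∙-cong = cong₂ _⊕_ }
            ; assoc = ⊕-assoc
            }
          ; identity = ⊕-identityˡ , λ i → trans (⊕-comm i 𝟘) (⊕-identityˡ i)
          }
        ; inverse = ⊖-inverseˡ , λ i → trans (⊕-comm i (⊖ i)) (⊖-inverseˡ i)
        ; ⁻¹-cong = cong ⊖_
        }
      ; comm = ⊕-comm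
      }
    }

  open AbelianGroup cyclicGroup public using () renaming (_-_ to _⊖_)
  open AbelianGroupProperties cyclicGroup using (//-rightDividesˡ; //-rightDividesʳ)
  open DifferenceIdentities cyclicGroup public

  -- the translation i ↦ i ⊕ c; for c = k this is exactly ρ n k
  translation : Fin n → Permutation′ n
  translation c = permutation (_⊕ c) (_⊖ c) (//-rightDividesˡ c) (//-rightDividesʳ c)

  μ-reflection : ∀ k i → μ n k i ≡ k ⊖ i
  μ-reflection k i = sym ([]-absorbʳ (toℕ k) (n ∸ toℕ i))

  reflection : Fin n → Permutation′ n
  reflection k = permutation (μ n k) (μ n k) μ-involutive μ-involutive
    where
    μ-involutive : ∀ i → μ n k (μ n k i) ≡ i
    μ-involutive i = begin
      μ n k (μ n k i)  ≡⟨ μ-reflection k (μ n k i) ⟩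
      k ⊖ μ n k i      ≡⟨ cong (λ j → k ⊖ j) (μ-reflection k i) ⟩
      k ⊖ (k ⊖ i)      ≡⟨ reflection-involutive k i ⟩
      i                ∎

module Reindexing {a ℓ : Level} (M : CommutativeMonoid a ℓ)
  (big : ∀ {m} → (Fin m → CommutativeMonoid.Carrier M) → CommutativeMonoid.Carrier M)
  (big≡sum : ∀ {m} f → big {m} f ≡ CommutativeMonoidSum.sum M f) where
  open CommutativeMonoid M
  open CommutativeMonoidSum M using (sum; sum-cong-≋; sum-permute)
  open SetoidReasoning setoid

  big-cong : ∀ {m} {f g : Fin m → Carrier} → (∀ i → f i ≈ g i) → big f ≈ big g
  big-cong {f = f} {g} f≈g = begin
    big f  ≡⟨ big≡sum f ⟩
    sum f  ≈⟨ sum-cong-≋ f≈g ⟩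
    sum g  ≡⟨ big≡sum g ⟨
    big g  ∎

  big-permute : ∀ {m} (f : Fin m → Carrier) (π : Permutation′ m) →
                big f ≈ big (λ i → f (π ⟨$⟩ʳ i))
  big-permute f π = begin
    big f                       ≡⟨ big≡sum f ⟩
    sum f                       ≈⟨ sum-permute f π ⟩
    sum (λ i → f (π ⟨$⟩ʳ i))    ≡⟨ big≡sum _ ⟨
    big (λ i → f (π ⟨$⟩ʳ i))    ∎

module BigOperators {c ℓ : Level} (R : CommutativeRing c ℓ) where
  open CommutativeRing R using (Carrier; _+_; _*_; +-commutativeMonoid; *-commutativeMonoid)
  open Dih R

  ∑≡sum : ∀ {m} (f : Fin m → Carrier) → ∑ f ≡ CommutativeMonoidSum.sum +-commutativeMonoid f
  ∑≡sum {Nat.zero} f = refl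
  ∑≡sum {Nat.suc m} f = cong (f Fin.zero +_) (∑≡sum (λ i → f (Fin.suc i)))

  ∏≡sum : ∀ {m} (f : Fin m → Carrier) → ∏ f ≡ CommutativeMonoidSum.sum *-commutativeMonoid f
  ∏≡sum {Nat.zero} f = refl
  ∏≡sum {Nat.suc m} f = cong (f Fin.zero *_) (∏≡sum (λ i → f (Fin.suc i)))

  open Reindexing +-commutativeMonoid ∑ ∑≡sum public
    renaming (big-cong to ∑-cong; big-permute to ∑-permute)
  open Reindexing *-commutativeMonoid ∏ ∏≡sum public
    renaming (big-cong to ∏-cong; big-permute to ∏-permute)

module TwoRowPattern {c ℓ : Level} (R : CommutativeRing c ℓ) {n : ℕ}
  (A : Dih.Matrix R n) (a b : Fin n → CommutativeRing.Carrier R) (p q : Fin n)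
  (rows-a : ∀ i j → (i ≡ p ⊎ i ≡ q) → CommutativeRing._≈_ R (A i j) (a j))
  (rows-b : ∀ i j → i ≢ p → i ≢ q → CommutativeRing._≈_ R (A i j) (b j)) where
  open CommutativeRing R using (Carrier; _≈_; reflexive; setoid)
  open Dih R
  open BigOperators R
  open SetoidReasoning setoid

  -- the entry met in column j when rows p and q are sent to columns x, y
  entry : Fin n → Fin n → Fin n → Carrier
  entry x y j with j ≟ x | j ≟ y
  ... | yes _ | _     = a j
  ... | no _  | yes _ = a j
  ... | no _  | no _  = b j

  diagonal : Fin n → Fin n → Carrier
  diagonal x y = ∏ (entry x y)

  diagonal-sym : ∀ x y → diagonal x y ≈ diagonal y x
  diagonal-sym x y = ∏-cong (λ j → reflexive (entry-sym j))
    where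
    entry-sym : ∀ j → entry x y j ≡ entry y x j
    entry-sym j with j ≟ x | j ≟ y
    ... | yes _ | yes _ = refl
    ... | yes _ | no _  = refl
    ... | no _  | yes _ = refl
    ... | no _  | no _  = refl

  -- column j of the permuted diagonal lies in row π⁻¹ j, which is p or q
  -- exactly when j is π p or π q
  column : (π : Permutation′ n) → ∀ j → A (π ⟨$⟩ˡ j) j ≈ entry (π ⟨$⟩ʳ p) (π ⟨$⟩ʳ q) j
  column π j with j ≟ π ⟨$⟩ʳ p | j ≟ π ⟨$⟩ʳ q
  ... | yes j≡πp | _        = rows-a _ _ (inj₁ (trans (cong (π ⟨$⟩ˡ_) j≡πp) (inverseˡ π)))
  ... | no _     | yes j≡πq = rows-a _ _ (inj₂ (trans (cong (π ⟨$⟩ˡ_) j≡πq) (inverseˡ π)))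
  ... | no j≢πp  | no j≢πq  = rows-b _ _ (λ e → j≢πp (sent-to e)) (λ e → j≢πq (sent-to e))
    where
    sent-to : ∀ {i} → π ⟨$⟩ˡ j ≡ i → j ≡ π ⟨$⟩ʳ i
    sent-to e = trans (sym (inverseʳ π)) (cong (π ⟨$⟩ʳ_) e)

  diagonal-product : (π : Permutation′ n) →
                     ∏ (λ i → A i (π ⟨$⟩ʳ i)) ≈ diagonal (π ⟨$⟩ʳ p) (π ⟨$⟩ʳ q)
  diagonal-product π = begin
    ∏ (λ i → A i (π ⟨$⟩ʳ i))                ≈⟨ ∏-permute (λ i → A i (π ⟨$⟩ʳ i)) (flip π) ⟩
    ∏ (λ j → A (π ⟨$⟩ˡ j) (π ⟨$⟩ʳ (π ⟨$⟩ˡ j))) ≈⟨ ∏-cong (λ j → reflexive (cong (A (π ⟨$⟩ˡ j)) (inverseʳ π))) ⟩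
    ∏ (λ j → A (π ⟨$⟩ˡ j) j)                ≈⟨ ∏-cong (column π) ⟩
    diagonal (π ⟨$⟩ʳ p) (π ⟨$⟩ʳ q)          ∎

module DihedrantHalves {c ℓ : Level} (R : CommutativeRing c ℓ) (n : ℕ) .{{_ : NonZero n}}
  (A : Dih.Matrix R n) (a b : Fin n → CommutativeRing.Carrier R) (p q : Fin n)
  (rows-a : ∀ i j → (i ≡ p ⊎ i ≡ q) → CommutativeRing._≈_ R (A i j) (a j))
  (rows-b : ∀ i j → i ≢ p → i ≢ q → CommutativeRing._≈_ R (A i j) (b j)) where
  open CommutativeRing R using (Carrier; _≈_; setoid)
  open Dih R
  open BigOperators R
  open Cyclic n
  open TwoRowPattern R A a b p q rows-a rows-b
  open SetoidReasoning setoid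

  G : Fin n → Carrier
  G k = diagonal (p ⊕ k) (q ⊕ k)

  -- ρ n k is the translation by k, which sends p, q to p ⊕ k, q ⊕ k
  ρ-half : ∑ (λ k → ∏ (λ i → A i (ρ n k i))) ≈ ∑ G
  ρ-half = ∑-cong (λ k → diagonal-product (translation k))

  μ-term : ∀ k → ∏ (λ i → A i (μ n k i)) ≈ G (k ⊖ (p ⊕ q))
  μ-term k = begin
    ∏ (λ i → A i (μ n k i))        ≈⟨ diagonal-product (reflection k) ⟩
    diagonal (μ n k p) (μ n k q)   ≡⟨ cong₂ diagonal (μ-reflection k p) (μ-reflection k q) ⟩
    diagonal (k ⊖ p) (k ⊖ q)       ≈⟨ diagonal-sym _ _ ⟩
    diagonal (k ⊖ q) (k ⊖ p)       ≡⟨ cong₂ diagonal (translate-reflection k p q) q-shift ⟨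
    G (k ⊖ (p ⊕ q))                ∎
    where
    q-shift : q ⊕ (k ⊖ (p ⊕ q)) ≡ k ⊖ p
    q-shift = trans (cong (λ s → q ⊕ (k ⊖ s)) (⊕-comm p q)) (translate-reflection k q p)

  μ-half : ∑ (λ k → ∏ (λ i → A i (μ n k i))) ≈ ∑ G
  μ-half = begin
    ∑ (λ k → ∏ (λ i → A i (μ n k i)))  ≈⟨ ∑-cong μ-term ⟩
    ∑ (λ k → G (k ⊖ (p ⊕ q)))          ≈⟨ ∑-permute G (flip (translation (p ⊕ q))) ⟨
    ∑ G                                ∎

-- The theorem: dih A = ∑ G - ∑ G = 0.
theorem6 : ∀ {c ℓ : Level} (R : CommutativeRing c ℓ) →
    let open CommutativeRing R
        open Dih R
    in (n : ℕ) .{{_ : NonZero n}} → 2 ≤ n →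
       (A : Matrix n) (a b : Fin n → Carrier) (p q : Fin n) → p ≢ q →
       (∀ i j → (i ≡ p ⊎ i ≡ q) → A i j ≈ a j) →
       (∀ i j → i ≢ p → i ≢ q → A i j ≈ b j) →
       dih n A ≈ 0#
theorem6 R n _ A a b p q _ rows-a rows-b = begin
  dih n A    ≈⟨ +-cong ρ-half (-‿cong μ-half) ⟩
  ∑ G - ∑ G  ≈⟨ -‿inverseʳ (∑ G) ⟩
  0#         ∎
  where
  open CommutativeRing R
  open Dih R
  open DihedrantHalves R n A a b p q rows-a rows-b
  open SetoidReasoning setoid
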